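{- Let $G=(V,E)$ be a word-representable graph whose connected components are $G_i=(V_i,E_i)$ for $i=1,\dots,k$. Then $$\ell(G)\le \sum_{i=1}^k\bigl(\ell(G_i)+|V_i|\bigr)-\max_{1\le j\le k}|V_j|.$$
   Context: All graphs are finite, simple and undirected. A graph $G=(V,E)$ is word-representable if there is a finite word $w$ over the alphabet $V$, containing every letter of $V$ at least once, such that for all distinct $x,y\in V$, $xy\in E$ if and only if $x$ and $y$ alternate in $w$ (i.e. the subword of $w$ consisting only of the occurrences of $x$ and $y$ has no two equal consecutive letters). Such a $w$ is said to word-represent $G$. For a word-representable graph $G$, $\ell(G)$ denotes the minimum length of a word that word-represents $G$. -}

module Defs where

open import Level using (0ℓ)
open import Data.Nat using (ℕ; _+_; _∸_; _⊔_; _≤_)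
open import Data.Fin using (Fin; _≟_)
open import Data.List using (List; []; _∷_; length; filter; concat; map; foldr; zipWith; allFin)
open import Data.List.Membership.Propositional using (_∈_)
open import Data.List.Relation.Unary.Linked using (Linked)
open import Data.List.Relation.Binary.Pointwise using (Pointwise)
open import Data.List.Relation.Binary.Permutation.Propositional using (_↭_)
open import Data.Product using (_×_; ∃)
open import Data.Sum using (_⊎_)
open import Relation.Nullary using (¬_)
open import Relation.Nullary.Decidable using (_⊎-dec_)
open import Relation.Binary.PropositionalEquality using (_≡_; _≢_)
open import Relation.Binary.Construct.Closure.ReflexiveTransitive using (Star)
open import Function.Bundles using (_⇔_)

record Graph (n : ℕ) : Set₁ where
  field
    Adj   : Fin n → Fin n → Set
    sym   : ∀ {x y} → Adj x y → Adj y x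
    irrefl : ∀ {x} → ¬ Adj x x
open Graph public

restrict : ∀ {n} → Fin n → Fin n → List (Fin n) → List (Fin n)
restrict x y = filter (λ z → (z ≟ x) ⊎-dec (z ≟ y))

Alternate : ∀ {n} → List (Fin n) → Fin n → Fin n → Set
Alternate w x y = Linked _≢_ (restrict x y w)

Represents : ∀ {n} → Graph n → List (Fin n) → List (Fin n) → Set
Represents G S w =
  (∀ z → z ∈ w → z ∈ S) ×
  (∀ x → x ∈ S → x ∈ w) ×
  (∀ x y → x ∈ S → y ∈ S → x ≢ y → (Adj G x y ⇔ Alternate w x y))

WordRepresentableOn : ∀ {n} → Graph n → List (Fin n) → Set
WordRepresentableOn G S = ∃ λ w → Represents G S w

WordRepresentable : ∀ {n} → Graph n → Set
WordRepresentable G = WordRepresentableOn G (allFin _)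

IsMinRepLength : ∀ {n} → Graph n → List (Fin n) → ℕ → Set
IsMinRepLength G S m =
  (∃ λ w → Represents G S w × length w ≡ m) ×
  (∀ w → Represents G S w → m ≤ length w)

Reachable : ∀ {n} → Graph n → Fin n → Fin n → Set
Reachable G = Star (Adj G)

IsComponentList : ∀ {n} → Graph n → List (List (Fin n)) → Set
IsComponentList {n} G Cs =
  (concat Cs ↭ allFin n) ×
  (∀ C → C ∈ Cs →
     (∃ λ v → v ∈ C) ×
     (∀ x y → x ∈ C → (y ∈ C ⇔ Reachable G x y)))

maxℕ : List ℕ → ℕ
maxℕ = foldr _⊔_ 0

-- Let p(w) = deduplicate w list the letters of w in order of first occurrence.
-- Then p(w) w represents the same graph as w: restricted to two letters x, y
-- occurring in w, p(w) is the first letter of the restriction of w followed by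
-- the other one. Moreover every letter t occurs twice in p(w) w with only letters
-- of its own component in between, so in any concatenation t alternates with no
-- letter of another component. Hence the words p(wᵢ) wᵢ of all components but
-- one, followed or preceded by a minimal word wⱼ of the remaining component,
-- represent G; as |p(wᵢ)| ≤ |Vᵢ|, keeping a largest component j plain gives the
-- bound.
module Submission where

open import Defs hiding (sym)
open import Data.Nat using (ℕ; suc; _+_; _∸_; _≤_; _⊔_; z≤n; s≤s)
open import Data.Nat.Properties
  using (≤-refl; ≤-trans; ≤-total; +-comm; +-assoc; +-mono-≤; +-monoˡ-≤; +-suc;
         m≤n⇒m⊔n≡n; m≥n⇒m⊔n≡m; m+n≤o⇒m≤o∸n; module ≤-Reasoning)
open import Data.Nat.ListAction using (sum)
open import Data.Fin using (Fin; _≟_)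
open import Data.List using (List; []; _∷_; [_]; _++_; length; map; zipWith; concat; filter; deduplicate; allFin)
open import Data.List.Properties
  using (filter-++; filter-accept; filter-reject; filter-all; filter-none; filter-≐;
         ++-assoc; ++-identityʳ; length-++)
open import Data.List.Membership.Propositional using (_∈_; _∉_)
open import Data.List.Membership.Propositional.Properties
  using (∈-++⁺ˡ; ∈-++⁺ʳ; ∈-++⁻; ∈-∃++; ∈-filter⁺; ∈-filter⁻; ∈-deduplicate⁺; ∈-deduplicate⁻)
open import Data.List.Relation.Binary.Subset.Propositional using (_⊆_)
open import Data.List.Relation.Binary.Disjoint.Propositional using (Disjoint)
open import Data.List.Relation.Binary.Pointwise using (Pointwise; []; _∷_)
open import Data.List.Relation.Binary.Permutation.Propositional using (_↭_; ↭-sym; ↭⇒↭ₛ)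
open import Data.List.Relation.Binary.Permutation.Propositional.Properties using (∈-resp-↭)
open import Data.List.Relation.Binary.Permutation.Setoid.Properties using (Unique-resp-↭)
open import Data.List.Relation.Unary.Any using (here; there)
open import Data.List.Relation.Unary.All as All using (All; []; _∷_)
open import Data.List.Relation.Unary.AllPairs using ([]; _∷_)
open import Data.List.Relation.Unary.Linked as Linked using (Linked; _∷_)
open import Data.List.Relation.Unary.Unique.Propositional using (Unique)
open import Data.List.Relation.Unary.Unique.Propositional.Properties using (allFin⁺)
import Data.List.Relation.Unary.Unique.Propositional.Properties as Unique
open import Data.List.Relation.Unary.Unique.DecPropositional.Properties using (deduplicate-!)
open import Data.Product using (_×_; _,_; proj₁; proj₂; ∃; ∃₂)
open import Data.Sum as Sum using (_⊎_; inj₁; inj₂)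
open import Data.Empty using (⊥-elim)
open import Function using (_∘_)
open import Function.Bundles using (_⇔_; mk⇔; Equivalence)
import Function.Properties.Equivalence as ⇔
open import Relation.Nullary using (¬_; Dec; yes; no; ¬?; _⊎-dec_)
open import Relation.Binary.Definitions using (DecidableEquality)
open import Relation.Binary.PropositionalEquality
  using (_≡_; _≢_; refl; sym; trans; cong; cong₂; subst; setoid; module ≡-Reasoning)
open import Relation.Binary.Construct.Closure.ReflexiveTransitive using (ε; _◅_)

module _ {A : Set} where

  linked-++⁻ʳ : ∀ {R : A → A → Set} xs {ys} → Linked R (xs ++ ys) → Linked R ys
  linked-++⁻ʳ []       l = l
  linked-++⁻ʳ (x ∷ xs) l = linked-++⁻ʳ xs (Linked.tail l)

  unique-++⁻ : ∀ xs {ys : List A} → Unique (xs ++ ys) → Unique ys × Disjoint xs ys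
  unique-++⁻ []       u = u , λ ()
  unique-++⁻ (x ∷ xs) (x∉ ∷ u) with unique-++⁻ xs u
  ... | uys , disjoint = uys , λ where
    (here refl , v∈ys) → All.lookup x∉ (∈-++⁺ʳ xs v∈ys) refl
    (there v∈xs , v∈ys) → disjoint (v∈xs , v∈ys)

  unique⇒length≤ : ∀ {xs ys : List A} → Unique xs → xs ⊆ ys → length xs ≤ length ys
  unique⇒length≤ {[]}     _         _  = z≤n
  unique⇒length≤ {x ∷ xs} (x∉ ∷ u) xs⊆ys with ∈-∃++ (xs⊆ys (here refl))
  ... | as , bs , refl = begin
    suc (length xs)             ≤⟨ s≤s (unique⇒length≤ u xs⊆as++bs) ⟩
    suc (length (as ++ bs))     ≡⟨ cong suc (length-++ as) ⟩
    suc (length as + length bs) ≡⟨ sym (+-suc (length as) (length bs)) ⟩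
    length as + length (x ∷ bs) ≡⟨ sym (length-++ as) ⟩
    length (as ++ x ∷ bs)       ∎
    where
    open ≤-Reasoning
    xs⊆as++bs : xs ⊆ as ++ bs
    xs⊆as++bs {z} z∈xs with ∈-++⁻ as (xs⊆ys (there z∈xs))
    ... | inj₁ z∈as         = ∈-++⁺ˡ z∈as
    ... | inj₂ (here refl)  = ⊥-elim (All.lookup x∉ z∈xs refl)
    ... | inj₂ (there z∈bs) = ∈-++⁺ʳ as z∈bs

  unique-all≡⇒singleton : ∀ {s : A} {xs} → Unique xs → All (_≡ s) xs → s ∈ xs → xs ≡ [ s ]
  unique-all≡⇒singleton _                (refl ∷ [])         _ = refl
  unique-all≡⇒singleton ((s≢t ∷ _) ∷ _) (refl ∷ refl ∷ _) _ = ⊥-elim (s≢t refl)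

  filter-comm : ∀ {P Q : A → Set} (P? : ∀ z → Dec (P z)) (Q? : ∀ z → Dec (Q z)) xs →
    filter P? (filter Q? xs) ≡ filter Q? (filter P? xs)
  filter-comm P? Q? [] = refl
  filter-comm {P} {Q} P? Q? (z ∷ xs) = commute (P? z) (Q? z)
    where
    commute : Dec (P z) → Dec (Q z) → filter P? (filter Q? (z ∷ xs)) ≡ filter Q? (filter P? (z ∷ xs))
    commute (yes p) (yes q)
      rewrite filter-accept Q? {xs = xs} q | filter-accept P? {xs = filter Q? xs} p
            | filter-accept P? {xs = xs} p | filter-accept Q? {xs = filter P? xs} q
      = cong (z ∷_) (filter-comm P? Q? xs)
    commute (yes p) (no ¬q)
      rewrite filter-reject Q? {xs = xs} ¬q | filter-accept P? {xs = xs} p | filter-reject Q? {xs = filter P? xs} ¬q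
      = filter-comm P? Q? xs
    commute (no ¬p) (yes q)
      rewrite filter-accept Q? {xs = xs} q | filter-reject P? {xs = filter Q? xs} ¬p | filter-reject P? {xs = xs} ¬p
      = filter-comm P? Q? xs
    commute (no ¬p) (no ¬q)
      rewrite filter-reject Q? {xs = xs} ¬q | filter-reject P? {xs = xs} ¬p
      = filter-comm P? Q? xs

  module _ (_≟ᴬ_ : DecidableEquality A) where

    private
      dedup : List A → List A
      dedup = deduplicate _≟ᴬ_

    filter-deduplicate : ∀ {P : A → Set} (P? : ∀ z → Dec (P z)) xs →
      filter P? (dedup xs) ≡ dedup (filter P? xs)
    filter-deduplicate P? [] = refl
    filter-deduplicate {P} P? (x ∷ xs) = split (P? x)
      where
      x∉ = ¬? ∘ (x ≟ᴬ_)
      open ≡-Reasoning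
      split : Dec (P x) → filter P? (dedup (x ∷ xs)) ≡ dedup (filter P? (x ∷ xs))
      split (yes p) = begin
        filter P? (x ∷ filter x∉ (dedup xs)) ≡⟨ filter-accept P? p ⟩
        x ∷ filter P? (filter x∉ (dedup xs)) ≡⟨ cong (x ∷_) (filter-comm P? x∉ (dedup xs)) ⟩
        x ∷ filter x∉ (filter P? (dedup xs)) ≡⟨ cong (λ ys → x ∷ filter x∉ ys) (filter-deduplicate P? xs) ⟩
        x ∷ filter x∉ (dedup (filter P? xs)) ≡⟨ cong dedup (sym (filter-accept P? p)) ⟩
        dedup (filter P? (x ∷ xs))           ∎
      split (no ¬p) = begin
        filter P? (x ∷ filter x∉ (dedup xs)) ≡⟨ filter-reject P? ¬p ⟩
        filter P? (filter x∉ (dedup xs))     ≡⟨ filter-comm P? x∉ (dedup xs) ⟩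
        filter x∉ (filter P? (dedup xs))     ≡⟨ cong (filter x∉) (filter-deduplicate P? xs) ⟩
        filter x∉ (dedup (filter P? xs))     ≡⟨ filter-all x∉ (All.tabulate x≢) ⟩
        dedup (filter P? xs)                 ≡⟨ cong dedup (sym (filter-reject P? ¬p)) ⟩
        dedup (filter P? (x ∷ xs))           ∎
        where
        x≢ : ∀ {z} → z ∈ dedup (filter P? xs) → x ≢ z
        x≢ z∈ refl = ¬p (proj₂ (∈-filter⁻ P? {xs = xs} (∈-deduplicate⁻ _≟ᴬ_ (filter P? xs) z∈)))

    -- Here dedup (f ∷ r) = f ∷ [ s ], a prefix that f ∷ r absorbs without breaking alternation.
    linked-deduplicate-∷-++ : ∀ {f s : A} {r} → f ≢ s → All (λ z → z ≡ f ⊎ z ≡ s) r → s ∈ r →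
      Linked _≢_ (dedup (f ∷ r) ++ f ∷ r) ⇔ Linked _≢_ (f ∷ r)
    linked-deduplicate-∷-++ {f} {s} {r} f≢s r⊆fs s∈r =
      subst (λ rest → Linked _≢_ (f ∷ rest ++ f ∷ r) ⇔ Linked _≢_ (f ∷ r)) (sym others≡[s])
        (mk⇔ (Linked.tail ∘ Linked.tail) (λ l → f≢s ∷ (f≢s ∘ sym) ∷ l))
      where
      f∉ = ¬? ∘ (f ≟ᴬ_)
      others≡s : All (_≡ s) (filter f∉ (dedup r))
      others≡s = All.tabulate λ z∈ → let z∈dedup , f≢z = ∈-filter⁻ f∉ z∈ in
        Sum.[ (λ z≡f → ⊥-elim (f≢z (sym z≡f))) , (λ z≡s → z≡s) ]
          (All.lookup r⊆fs (∈-deduplicate⁻ _≟ᴬ_ r z∈dedup))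
      others≡[s] : filter f∉ (dedup r) ≡ [ s ]
      others≡[s] = unique-all≡⇒singleton (Unique.filter⁺ f∉ (deduplicate-! _≟ᴬ_ r)) others≡s
        (∈-filter⁺ f∉ (∈-deduplicate⁺ _≟ᴬ_ s∈r) f≢s)

    linked-deduplicate-++ : ∀ {x y : A} {r} → x ≢ y → All (λ z → z ≡ x ⊎ z ≡ y) r → x ∈ r → y ∈ r →
      Linked _≢_ (dedup r ++ r) ⇔ Linked _≢_ r
    linked-deduplicate-++ x≢y (inj₁ refl ∷ _)   _           (here refl) = ⊥-elim (x≢y refl)
    linked-deduplicate-++ x≢y (inj₁ refl ∷ r⊆) _           (there y∈r) = linked-deduplicate-∷-++ x≢y r⊆ y∈r
    linked-deduplicate-++ x≢y (inj₂ refl ∷ _)   (here refl) _           = ⊥-elim (x≢y refl)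
    linked-deduplicate-++ x≢y (inj₂ refl ∷ r⊆) (there x∈r) _           =
      linked-deduplicate-∷-++ (x≢y ∘ sym) (All.map Sum.swap r⊆) x∈r

cost : ∀ {A : Set} → List (List A) → List ℕ → ℕ
cost Cs ℓs = sum (zipWith _+_ ℓs (map length Cs))

module _ {n : ℕ} where

  private
    keep? : (x y z : Fin n) → Dec (z ≡ x ⊎ z ≡ y)
    keep? x y z = (z ≟ x) ⊎-dec (z ≟ y)

    dedup : List (Fin n) → List (Fin n)
    dedup = deduplicate _≟_

  restrict-++ : ∀ x y (u v : List (Fin n)) → restrict x y (u ++ v) ≡ restrict x y u ++ restrict x y v
  restrict-++ x y = filter-++ (keep? x y)

  restrict-∷ : ∀ x y (w : List (Fin n)) → restrict x y (x ∷ w) ≡ x ∷ restrict x y w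
  restrict-∷ x y w = filter-accept (keep? x y) (inj₁ refl)

  restrict-comm : ∀ x y (w : List (Fin n)) → restrict x y w ≡ restrict y x w
  restrict-comm x y = filter-≐ (keep? x y) (keep? y x) (Sum.swap , Sum.swap)

  restrict-absent : ∀ {x y} {w : List (Fin n)} → x ∉ w → y ∉ w → restrict x y w ≡ []
  restrict-absent {x} {y} {w} x∉w y∉w = filter-none (keep? x y) {xs = w} (All.tabulate λ z∈w →
    Sum.[ (λ { refl → x∉w z∈w }) , (λ { refl → y∉w z∈w }) ])

  alternate-comm : ∀ {x y} (w : List (Fin n)) → Alternate w x y → Alternate w y x
  alternate-comm {x} {y} w = subst (Linked _≢_) (restrict-comm x y w)

  alternate-++⁻ˡ : ∀ {x y} (u v : List (Fin n)) → x ∉ v → y ∉ v → Alternate (u ++ v) x y ⇔ Alternate u x y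
  alternate-++⁻ˡ {x} {y} u v x∉v y∉v
    rewrite restrict-++ x y u v | restrict-absent x∉v y∉v | ++-identityʳ (restrict x y u) = ⇔.refl

  alternate-++⁻ʳ : ∀ {x y} (u v : List (Fin n)) → x ∉ u → y ∉ u → Alternate (u ++ v) x y ⇔ Alternate v x y
  alternate-++⁻ʳ {x} {y} u v x∉u y∉u rewrite restrict-++ x y u v | restrict-absent x∉u y∉u = ⇔.refl

  -- Between the two displayed copies of t only t itself survives restriction to {t, y}.
  ¬alternate-twice : ∀ {t y} (a b c : List (Fin n)) → y ∉ b → ¬ Alternate (a ++ t ∷ b ++ t ∷ c) t y
  ¬alternate-twice {t} {y} a b c y∉b alternating =
    ¬linked (restrict t y b) between≡t (linked-++⁻ʳ (restrict t y a) (subst (Linked _≢_) splits alternating))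
    where
    open ≡-Reasoning
    splits : restrict t y (a ++ t ∷ b ++ t ∷ c) ≡ restrict t y a ++ t ∷ restrict t y b ++ t ∷ restrict t y c
    splits = begin
      restrict t y (a ++ t ∷ b ++ t ∷ c)                       ≡⟨ restrict-++ t y a _ ⟩
      restrict t y a ++ restrict t y (t ∷ b ++ t ∷ c)           ≡⟨ cong (restrict t y a ++_) (restrict-∷ t y _) ⟩
      restrict t y a ++ t ∷ restrict t y (b ++ t ∷ c)           ≡⟨ cong (λ r → restrict t y a ++ t ∷ r) (restrict-++ t y b _) ⟩
      restrict t y a ++ t ∷ restrict t y b ++ restrict t y (t ∷ c)
        ≡⟨ cong (λ r → restrict t y a ++ t ∷ restrict t y b ++ r) (restrict-∷ t y c) ⟩
      restrict t y a ++ t ∷ restrict t y b ++ t ∷ restrict t y c ∎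
    between≡t : All (_≡ t) (restrict t y b)
    between≡t = All.tabulate λ z∈ → let z∈b , z≡t⊎y = ∈-filter⁻ (keep? t y) {xs = b} z∈ in
      Sum.[ (λ z≡t → z≡t) , (λ { refl → ⊥-elim (y∉b z∈b) }) ] z≡t⊎y
    ¬linked : ∀ rb {rc} → All (_≡ t) rb → ¬ Linked _≢_ (t ∷ rb ++ t ∷ rc)
    ¬linked []      _          l = Linked.head l refl
    ¬linked (_ ∷ _) (refl ∷ _) l = Linked.head l refl

  alternate-deduplicate-++ : ∀ {x y} {w : List (Fin n)} → x ∈ w → y ∈ w → x ≢ y →
    Alternate (dedup w ++ w) x y ⇔ Alternate w x y
  alternate-deduplicate-++ {x} {y} {w} x∈w y∈w x≢y
    rewrite restrict-++ x y (dedup w) w | filter-deduplicate _≟_ (keep? x y) w =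
    linked-deduplicate-++ _≟_ x≢y (All.tabulate (proj₂ ∘ ∈-filter⁻ (keep? x y) {xs = w}))
      (∈-filter⁺ (keep? x y) x∈w (inj₁ refl)) (∈-filter⁺ (keep? x y) y∈w (inj₂ refl))

  TwiceWithin : List (Fin n) → Fin n → List (Fin n) → Set
  TwiceWithin S t w = ∃₂ λ a b → ∃ λ c → w ≡ a ++ t ∷ b ++ t ∷ c × b ⊆ S

  twiceWithin-++⁺ˡ : ∀ {S t} {u : List (Fin n)} v → TwiceWithin S t u → TwiceWithin S t (u ++ v)
  twiceWithin-++⁺ˡ {t = t} v (a , b , c , refl , b⊆S) =
    a , b , c ++ v , trans (++-assoc a _ v) (cong (λ r → a ++ t ∷ r) (++-assoc b (t ∷ c) v)) , b⊆S

  twiceWithin-++⁺ʳ : ∀ {S t} (u : List (Fin n)) {v} → TwiceWithin S t v → TwiceWithin S t (u ++ v)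
  twiceWithin-++⁺ʳ u (a , b , c , refl , b⊆S) = u ++ a , b , c , sym (++-assoc u a _) , b⊆S

  twiceWithin-mono : ∀ {S S' t} {w : List (Fin n)} → S ⊆ S' → TwiceWithin S t w → TwiceWithin S' t w
  twiceWithin-mono S⊆S' (a , b , c , eq , b⊆S) = a , b , c , eq , S⊆S' ∘ b⊆S

  twiceWithin⇒¬alternate : ∀ {S t y} {w : List (Fin n)} → TwiceWithin S t w → y ∉ S → ¬ Alternate w t y
  twiceWithin⇒¬alternate (a , b , c , refl , b⊆S) y∉S = ¬alternate-twice a b c (y∉S ∘ b⊆S)

  twiceWithin-deduplicate-++ : ∀ {S t} {w : List (Fin n)} → w ⊆ S → t ∈ w → TwiceWithin S t (dedup w ++ w)
  twiceWithin-deduplicate-++ {S} {t} {w} w⊆S t∈w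
    with ∈-∃++ (∈-deduplicate⁺ _≟_ t∈w) | ∈-∃++ t∈w
  ... | a , b , dedup≡ | a' , c , w≡ = a , b ++ a' , c , splits , between⊆S
    where
    splits : dedup w ++ w ≡ a ++ t ∷ (b ++ a') ++ t ∷ c
    splits rewrite dedup≡ | w≡ = trans (++-assoc a (t ∷ b) _) (cong (λ r → a ++ t ∷ r) (sym (++-assoc b a' _)))
    between⊆S : b ++ a' ⊆ S
    between⊆S z∈ with ∈-++⁻ b z∈
    ... | inj₁ z∈b  = w⊆S (∈-deduplicate⁻ _≟_ w (subst (_ ∈_) (sym dedup≡) (∈-++⁺ʳ a (there z∈b))))
    ... | inj₂ z∈a' = w⊆S (subst (_ ∈_) (sym w≡) (∈-++⁺ˡ z∈a'))

  length-deduplicate-++ : ∀ {S} {w : List (Fin n)} → w ⊆ S → length (dedup w ++ w) ≤ length S + length w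
  length-deduplicate-++ {S} {w} w⊆S = begin
    length (dedup w ++ w)       ≡⟨ length-++ (dedup w) ⟩
    length (dedup w) + length w ≤⟨ +-monoˡ-≤ (length w) dedup≤S ⟩
    length S + length w         ∎
    where
    open ≤-Reasoning
    dedup≤S = unique⇒length≤ (deduplicate-! _≟_ w) (w⊆S ∘ ∈-deduplicate⁻ _≟_ w)

  module _ (G : Graph n) where

    Closed : List (Fin n) → Set
    Closed S = ∀ {x y} → x ∈ S → Adj G x y → y ∈ S

    DoublyRepresents : List (Fin n) → List (Fin n) → Set
    DoublyRepresents S w = Represents G S w × (∀ {t} → t ∈ S → TwiceWithin S t w)

    represents-resp-↭ : ∀ {S S' w} → S ↭ S' → Represents G S w → Represents G S' w
    represents-resp-↭ {S = S} {S'} S↭S' (w⊆S , S⊆w , adj⇔alt) =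
      (λ z z∈w → ∈-resp-↭ S↭S' (w⊆S z z∈w)) ,
      (λ x x∈S' → S⊆w x (back x∈S')) ,
      (λ x y x∈S' y∈S' → adj⇔alt x y (back x∈S') (back y∈S'))
      where
      back : ∀ {x} → x ∈ S' → x ∈ S
      back = ∈-resp-↭ (↭-sym S↭S')

    represents-[] : Represents G [] []
    represents-[] = (λ _ ()) , (λ _ ()) , (λ _ _ ())

    doublyRepresents-deduplicate-++ : ∀ {S w} → Represents G S w → DoublyRepresents S (dedup w ++ w)
    doublyRepresents-deduplicate-++ {S} {w} (w⊆S , S⊆w , adj⇔alt) =
      ( (λ z z∈ → Sum.[ w⊆S z ∘ ∈-deduplicate⁻ _≟_ w , w⊆S z ] (∈-++⁻ (dedup w) z∈))
      , (λ x x∈S → ∈-++⁺ʳ (dedup w) (S⊆w x x∈S))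
      , (λ x y x∈S y∈S x≢y → ⇔.trans (adj⇔alt x y x∈S y∈S x≢y)
                               (⇔.sym (alternate-deduplicate-++ (S⊆w x x∈S) (S⊆w y y∈S) x≢y))) )
      , λ {t} t∈S → twiceWithin-deduplicate-++ (λ {z} → w⊆S z) (S⊆w t t∈S)

    represents-++ : ∀ {C T L R} → Represents G C L → Represents G T R → Disjoint C T → Closed C →
      (∀ {x y} → x ∈ C → y ∈ T → ¬ Alternate (L ++ R) x y) → Represents G (C ++ T) (L ++ R)
    represents-++ {C} {T} {L} {R} (L⊆C , C⊆L , adjL) (R⊆T , T⊆R , adjR) C#T closedC ¬cross =
      L++R⊆C++T , C++T⊆L++R , adj⇔alt
      where
      L++R⊆C++T : ∀ z → z ∈ L ++ R → z ∈ C ++ T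
      L++R⊆C++T z z∈ = Sum.[ ∈-++⁺ˡ ∘ L⊆C z , ∈-++⁺ʳ C ∘ R⊆T z ] (∈-++⁻ L z∈)
      C++T⊆L++R : ∀ x → x ∈ C ++ T → x ∈ L ++ R
      C++T⊆L++R x x∈ = Sum.[ ∈-++⁺ˡ ∘ C⊆L x , ∈-++⁺ʳ L ∘ T⊆R x ] (∈-++⁻ C x∈)
      ∉R : ∀ {x} → x ∈ C → x ∉ R
      ∉R x∈C x∈R = C#T (x∈C , R⊆T _ x∈R)
      ∉L : ∀ {x} → x ∈ T → x ∉ L
      ∉L x∈T x∈L = C#T (L⊆C _ x∈L , x∈T)
      ¬adj : ∀ {x y} → x ∈ C → y ∈ T → ¬ Adj G x y
      ¬adj x∈C y∈T xy = C#T (closedC x∈C xy , y∈T)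
      adj⇔alt : ∀ x y → x ∈ C ++ T → y ∈ C ++ T → x ≢ y → Adj G x y ⇔ Alternate (L ++ R) x y
      adj⇔alt x y x∈ y∈ x≢y with ∈-++⁻ C x∈ | ∈-++⁻ C y∈
      ... | inj₁ x∈C | inj₁ y∈C =
        ⇔.trans (adjL x y x∈C y∈C x≢y) (⇔.sym (alternate-++⁻ˡ L R (∉R x∈C) (∉R y∈C)))
      ... | inj₂ x∈T | inj₂ y∈T =
        ⇔.trans (adjR x y x∈T y∈T x≢y) (⇔.sym (alternate-++⁻ʳ L R (∉L x∈T) (∉L y∈T)))
      ... | inj₁ x∈C | inj₂ y∈T = mk⇔ (⊥-elim ∘ ¬adj x∈C y∈T) (⊥-elim ∘ ¬cross x∈C y∈T)
      ... | inj₂ x∈T | inj₁ y∈C =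
        mk⇔ (⊥-elim ∘ ¬adj y∈C x∈T ∘ Graph.sym G) (⊥-elim ∘ ¬cross y∈C x∈T ∘ alternate-comm (L ++ R))

    represents-++-doubledˡ : ∀ {C T L R} → DoublyRepresents C L → Represents G T R → Disjoint C T → Closed C →
      Represents G (C ++ T) (L ++ R)
    represents-++-doubledˡ {R = R} (repL , twiceL) repR C#T closedC = represents-++ repL repR C#T closedC
      λ x∈C y∈T → twiceWithin⇒¬alternate (twiceWithin-++⁺ˡ R (twiceL x∈C)) (λ y∈C → C#T (y∈C , y∈T))

    represents-++-doubledʳ : ∀ {C T L R} → Represents G C L → DoublyRepresents T R → Disjoint C T → Closed C →
      Represents G (C ++ T) (L ++ R)
    represents-++-doubledʳ {L = L} {R} repL (repR , twiceR) C#T closedC = represents-++ repL repR C#T closedC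
      λ x∈C y∈T → twiceWithin⇒¬alternate (twiceWithin-++⁺ʳ L (twiceR y∈T)) (λ x∈T → C#T (x∈C , x∈T))
                  ∘ alternate-comm (L ++ R)

    doublyRepresents-++ : ∀ {C T L R} → DoublyRepresents C L → DoublyRepresents T R → Disjoint C T → Closed C →
      DoublyRepresents (C ++ T) (L ++ R)
    doublyRepresents-++ {C} {T} {L} {R} doubledL (repR , twiceR) C#T closedC =
      represents-++-doubledˡ doubledL repR C#T closedC ,
      λ t∈ → Sum.[ twiceWithin-mono ∈-++⁺ˡ ∘ twiceWithin-++⁺ˡ R ∘ proj₂ doubledL
                 , twiceWithin-mono (∈-++⁺ʳ C) ∘ twiceWithin-++⁺ʳ L ∘ twiceR ] (∈-++⁻ C t∈)

    doubledRepresentation : ∀ {Cs ℓs} → Unique (concat Cs) → All Closed Cs → Pointwise (IsMinRepLength G) Cs ℓs →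
      ∃ λ d → DoublyRepresents (concat Cs) d × length d ≤ cost Cs ℓs
    doubledRepresentation _ [] [] = [] , (represents-[] , λ ()) , z≤n
    doubledRepresentation {C ∷ Cs} {_ ∷ ℓs} u (closedC ∷ closed) (((wC , repC , refl) , _) ∷ minimal)
      with unique-++⁻ C u
    ... | uCs , C#Cs with doubledRepresentation uCs closed minimal
    ... | d , doubled , d≤ =
      (dedup wC ++ wC) ++ d ,
      doublyRepresents-++ (doublyRepresents-deduplicate-++ repC) doubled C#Cs closedC ,
      (begin
        length ((dedup wC ++ wC) ++ d)          ≡⟨ length-++ (dedup wC ++ wC) ⟩
        length (dedup wC ++ wC) + length d      ≤⟨ +-mono-≤ (length-deduplicate-++ (λ {z} → proj₁ repC z)) d≤ ⟩
        (length C + length wC) + cost Cs ℓs     ≡⟨ cong (_+ cost Cs ℓs) (+-comm (length C) (length wC)) ⟩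
        (length wC + length C) + cost Cs ℓs     ∎)
      where open ≤-Reasoning

    representation : ∀ {Cs ℓs} → Unique (concat Cs) → All Closed Cs → Pointwise (IsMinRepLength G) Cs ℓs →
      ∃ λ w → Represents G (concat Cs) w × length w + maxℕ (map length Cs) ≤ cost Cs ℓs
    representation _ [] [] = [] , represents-[] , z≤n
    representation {C ∷ Cs} {_ ∷ ℓs} u (closedC ∷ closed) (((wC , repC , refl) , _) ∷ minimal) =
      Sum.[ doubleC , keepC ]′ (≤-total (length C) M)
      where
      open ≤-Reasoning
      M = maxℕ (map length Cs)
      uCs = proj₁ (unique-++⁻ C u)
      C#Cs = proj₂ (unique-++⁻ C u)
      Goal : Set
      Goal = ∃ λ w → Represents G (C ++ concat Cs) w × length w + (length C ⊔ M) ≤ (length wC + length C) + cost Cs ℓs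

      doubleC : length C ≤ M → Goal
      doubleC C≤M with representation uCs closed minimal
      ... | w , rep , w+M≤ =
        (dedup wC ++ wC) ++ w ,
        represents-++-doubledˡ (doublyRepresents-deduplicate-++ repC) rep C#Cs closedC ,
        (begin
          length ((dedup wC ++ wC) ++ w) + (length C ⊔ M)  ≡⟨ cong₂ _+_ (length-++ (dedup wC ++ wC)) (m≤n⇒m⊔n≡n C≤M) ⟩
          (length (dedup wC ++ wC) + length w) + M        ≡⟨ +-assoc (length (dedup wC ++ wC)) (length w) M ⟩
          length (dedup wC ++ wC) + (length w + M)        ≤⟨ +-mono-≤ (length-deduplicate-++ (λ {z} → proj₁ repC z)) w+M≤ ⟩
          (length C + length wC) + cost Cs ℓs             ≡⟨ cong (_+ cost Cs ℓs) (+-comm (length C) (length wC)) ⟩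
          (length wC + length C) + cost Cs ℓs             ∎)

      keepC : M ≤ length C → Goal
      keepC M≤C with doubledRepresentation uCs closed minimal
      ... | d , doubled , d≤ =
        wC ++ d ,
        represents-++-doubledʳ repC doubled C#Cs closedC ,
        (begin
          length (wC ++ d) + (length C ⊔ M)    ≡⟨ cong₂ _+_ (length-++ wC) (m≥n⇒m⊔n≡m M≤C) ⟩
          (length wC + length d) + length C    ≡⟨ +-assoc (length wC) (length d) (length C) ⟩
          length wC + (length d + length C)    ≡⟨ cong (length wC +_) (+-comm (length d) (length C)) ⟩
          length wC + (length C + length d)    ≡⟨ sym (+-assoc (length wC) (length C) (length d)) ⟩
          (length wC + length C) + length d    ≤⟨ +-mono-≤ (≤-refl {length wC + length C}) d≤ ⟩
          (length wC + length C) + cost Cs ℓs  ∎)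

theorem2 : ∀ (n : ℕ) (G : Graph n) → WordRepresentable G →
    (Cs : List (List (Fin n))) → IsComponentList G Cs →
    (ℓs : List ℕ) → Pointwise (λ C m → IsMinRepLength G C m) Cs ℓs →
    (ℓG : ℕ) → IsMinRepLength G (allFin n) ℓG →
    ℓG ≤ sum (zipWith _+_ ℓs (map length Cs)) ∸ maxℕ (map length Cs)
theorem2 n G _ Cs (concat↭allFin , components) ℓs minimalCs ℓG (_ , minimalG) =
  let w , rep , w+M≤ = representation G unique closed minimalCs in
  ≤-trans (minimalG w (represents-resp-↭ G concat↭allFin rep)) (m+n≤o⇒m≤o∸n (length w) w+M≤)
  where
  unique : Unique (concat Cs)
  unique = Unique-resp-↭ (setoid (Fin n)) (↭⇒↭ₛ (↭-sym concat↭allFin)) (allFin⁺ n)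
  closed : All (Closed G) Cs
  closed = All.tabulate λ {C} C∈Cs {x} {y} x∈C xy →
    Equivalence.from (proj₂ (components C C∈Cs) x y x∈C) (xy ◅ ε)
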